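{- Let $G=(V,E)$ be a neutral graph and let $G^{\circ}$ be a disjoint copy of $G$, with $u^{\circ}$ denoting the copy of $u\in V$. Let $G^{\ominus}$ be the graph obtained from the disjoint union $G\cup G^{\circ}$ by joining each vertex $u\in V$ to all neighbours (in $G^{\circ}$) of its peer $u^{\circ}$, and likewise each $u^{\circ}$ to all neighbours (in $G$) of $u$; i.e. $G^{\ominus}$ has edge set $E\cup E^{\circ}\cup\{uv^{\circ},\,u^{\circ}v : uv\in E\}$. Then $G^{\ominus}$ has the same assortativity coefficient as $G$.
   Context: For a simple connected graph $G=(V,E)$ with $m\geq1$ edges, where $d_u$ is the degree of $u$ and $e_{uv}$ denotes the edge with endpoints $u,v$, the assortativity coefficient is $$r=\frac{m^{ -1}\sum_{e_{uv}\in E} d_{u}d_{v}-\Big[m^{ -1}\sum_{e_{uv}\in E} \tfrac{1}{2}(d_{u}+d_{v})\Big]^{2}}{m^{ -1}\sum_{e_{uv}\in E} \tfrac{1}{2}(d^{2}_{u}+d^{2}_{v})-\Big[m^{ -1}\sum_{e_{uv}\in E} \tfrac{1}{2}(d_{u}+d_{v})\Big]^{2}},$$ and $G$ is called neutral if $r$ is well defined (nonzero denominator) and $r=0$. -}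

module Defs where

open import Data.Nat using (ℕ; zero; suc; _<_; _≤_)
open import Data.Nat.Properties using (_<?_)
open import Data.Bool using (Bool; true; false; if_then_else_; _∧_)
open import Data.Fin using (Fin; toℕ; splitAt)
open import Data.List using (List; []; _∷_; length; map; sum; concatMap; filterᵇ; foldr; allFin)
open import Data.Product using (_×_; _,_)
open import Data.Sum using ([_,_]′)
open import Data.Maybe using (Maybe; just; nothing)
open import Data.Integer using (+_)
open import Data.Rational using (ℚ; _/_; 0ℚ; _+_; _*_; _-_; _÷_; ≢-nonZero)
open import Data.Rational.Properties using (_≟_)
open import Relation.Nullary using (yes; no)
open import Relation.Nullary.Decidable using (⌊_⌋)
open import Relation.Binary.PropositionalEquality using (_≡_)
open import Function using (id)

record Graph (n : ℕ) : Set where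
  field
    adj    : Fin n → Fin n → Bool
    sym    : ∀ u v → adj u v ≡ adj v u
    irrefl : ∀ u → adj u u ≡ false
open Graph public

module _ {n : ℕ} (G : Graph n) where

  deg : Fin n → ℕ
  deg u = length (filterᵇ (adj G u) (allFin n))

  edges : List (Fin n × Fin n)
  edges = concatMap (λ u → map (λ v → (u , v))
            (filterᵇ (λ v → ⌊ toℕ u <? toℕ v ⌋ ∧ adj G u v) (allFin n))) (allFin n)

  numEdges : ℕ
  numEdges = length edges

  edgeSum : (ℚ → ℚ → ℚ) → ℚ
  edgeSum f = foldr (λ { (u , v) acc → f (degℚ u) (degℚ v) + acc }) 0ℚ edges
    where
    degℚ : Fin n → ℚ
    degℚ u = (+ deg u) / 1

  half : ℚ
  half = + 1 / 2

  -- assortativity coefficient; `nothing` when it is not well defined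
  -- (m = 0 or zero denominator)
  assortativity : Maybe ℚ
  assortativity with numEdges
  ... | zero = nothing
  ... | suc k =
    let m⁻¹ = + 1 / suc k
        A   = m⁻¹ * edgeSum (λ a b → a * b)
        B   = m⁻¹ * edgeSum (λ a b → half * (a + b))
        C   = m⁻¹ * edgeSum (λ a b → half * (a * a + b * b))
        num = A - B * B
        den = C - B * B
    in helper num den
    where
    helper : ℚ → ℚ → Maybe ℚ
    helper num den with den ≟ 0ℚ
    ... | yes _ = nothing
    ... | no d≢0 = just (_÷_ num den {{≢-nonZero d≢0}})

  Neutral : Set
  Neutral = assortativity ≡ just 0ℚ

  data Reach : Fin n → Fin n → Set where
    here : ∀ {u} → Reach u u
    step : ∀ {u w v} → adj G u w ≡ true → Reach w v → Reach u v

  Connected : Set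
  Connected = ∀ u v → Reach u v

peer : ∀ {n} → Fin (n Data.Nat.+ n) → Fin n
peer {n} x = [ id , id ]′ (splitAt n x)

-- G^⊖ on vertex set Fin (n + n) = V ⊎ V°: x ~ y iff peer x ~ peer y in G,
-- i.e. edge set E ∪ E° ∪ {u v°, u° v : uv ∈ E}
shadow : ∀ {n} → Graph n → Graph (n Data.Nat.+ n)
shadow G = record
  { adj    = λ x y → adj G (peer x) (peer y)
  ; sym    = λ x y → sym G (peer x) (peer y)
  ; irrefl = λ x → irrefl G (peer x)
  }

-- Every vertex x of G⊖ has degree 2 d(peer x), and every edge uv of G yields exactly the four
-- edges uv, u°v°, uv°, u°v of G⊖.  Hence for a symmetric f the edge sum of f over the endpoint
-- degrees of G⊖ is four times that of G at doubled degrees, while m quadruples: the three edge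
-- means in r (of d_u d_v, (d_u + d_v)/2 and (d_u² + d_v²)/2) are multiplied by 4, 2 and 4, which
-- is a rescaling of the degree variable by 2, and a Pearson correlation is invariant under
-- rescaling.

module Submission where

open import Defs
open import Data.Nat using (ℕ; _≤_)
open import Relation.Binary.PropositionalEquality using (_≡_)

open import Algebra.Bundles using (CommutativeMonoid)
open import Algebra.Core using (Op₂)
open import Algebra.Structures using (IsCommutativeMonoid)
open import Data.Bool using (Bool; true; false; if_then_else_; _∧_)
open import Data.Fin using (Fin; zero; suc; toℕ; _↑ˡ_; _↑ʳ_)
open import Data.Fin.Properties using (toℕ-injective; toℕ-↑ˡ; toℕ-↑ʳ; toℕ<n; splitAt-↑ˡ; splitAt-↑ʳ)
open import Data.Integer using (+_)
import Data.Integer as ℤ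
import Data.Integer.Properties as ℤ
open import Data.List using (List; []; _∷_; _++_; foldr; length; map; concatMap; filterᵇ; tabulate; allFin)
open import Data.Maybe using (Maybe; just; nothing)
import Data.Nat as ℕ
import Data.Nat.Coprimality as Coprime
open import Data.Nat.Properties using (_<?_; <-asym; ≤-antisym; ≮⇒≥; <-≤-trans; m≤m+n; +-monoʳ-<; +-cancelˡ-<)
import Data.Nat.Properties as ℕ
open import Data.Product using (_,_)
open import Data.Rational using (ℚ; mkℚ; 0ℚ; 1ℚ; _/_; _+_; _-_; _*_; _÷_; 1/_; NonZero; ≢-nonZero)
import Data.Rational.Properties as ℚ
open import Data.Rational.Solver using (module +-*-Solver)
open import Data.Sum using ([_,_]′)
open import Function using (id; _∘_)
open import Level using (0ℓ)
open import Relation.Binary.PropositionalEquality using (refl; trans; cong; cong₂; module ≡-Reasoning)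
import Relation.Binary.PropositionalEquality as ≡
open import Relation.Nullary using (yes; no; contradiction)
open import Relation.Nullary.Decidable using (⌊_⌋)

peer-↑ˡ : ∀ {n} (u : Fin n) → peer (u ↑ˡ n) ≡ u
peer-↑ˡ {n} u = cong [ id , id ]′ (splitAt-↑ˡ n u n)

peer-↑ʳ : ∀ {n} (u : Fin n) → peer (n ↑ʳ u) ≡ u
peer-↑ʳ {n} u = cong [ id , id ]′ (splitAt-↑ʳ n n u)

module FiniteSums {A : Set} {_∙_ : Op₂ A} {ε : A}
                  (isCommutativeMonoid : IsCommutativeMonoid _≡_ _∙_ ε) where

  open IsCommutativeMonoid isCommutativeMonoid using (identityˡ; identityʳ; assoc)

  commutativeMonoid : CommutativeMonoid 0ℓ 0ℓ
  commutativeMonoid = record { isCommutativeMonoid = isCommutativeMonoid }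

  open import Algebra.Definitions.RawMonoid (CommutativeMonoid.rawMonoid commutativeMonoid) public
    using (_×_)
  open import Algebra.Solver.CommutativeMonoid commutativeMonoid
    using (solve; _⊕_; _⊜_) renaming (id to ∅)
  open import Algebra.Properties.CommutativeMonoid.Sum commutativeMonoid public
    using (sum; sum-syntax; sum-cong-≗; sum-replicate-zero; ∑-distrib-+; ∑-comm)

  listSum : {B : Set} → (B → A) → List B → A
  listSum g = foldr (λ x acc → g x ∙ acc) ε

  listSum-cong : {B : Set} {g h : B → A} → (∀ x → g x ≡ h x) → ∀ xs →
                 listSum g xs ≡ listSum h xs
  listSum-cong g≗h []       = refl
  listSum-cong g≗h (x ∷ xs) = cong₂ _∙_ (g≗h x) (listSum-cong g≗h xs)

  listSum-++ : {B : Set} (g : B → A) (xs ys : List B) →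
               listSum g (xs ++ ys) ≡ listSum g xs ∙ listSum g ys
  listSum-++ g []       ys = ≡.sym (identityˡ _)
  listSum-++ g (x ∷ xs) ys = trans (cong (g x ∙_) (listSum-++ g xs ys)) (≡.sym (assoc _ _ _))

  listSum-map : {B C : Set} (g : C → A) (k : B → C) (xs : List B) →
                listSum g (map k xs) ≡ listSum (g ∘ k) xs
  listSum-map g k []       = refl
  listSum-map g k (x ∷ xs) = cong (g (k x) ∙_) (listSum-map g k xs)

  listSum-concatMap : {B C : Set} (g : C → A) (h : B → List C) (xs : List B) →
                      listSum g (concatMap h xs) ≡ listSum (listSum g ∘ h) xs
  listSum-concatMap g h []       = refl
  listSum-concatMap g h (x ∷ xs) =
    trans (listSum-++ g (h x) (concatMap h xs))
          (cong (listSum g (h x) ∙_) (listSum-concatMap g h xs))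

  listSum-filterᵇ : {B : Set} (g : B → A) (p : B → Bool) (xs : List B) →
                    listSum g (filterᵇ p xs) ≡ listSum (λ x → if p x then g x else ε) xs
  listSum-filterᵇ g p []       = refl
  listSum-filterᵇ g p (x ∷ xs) with p x
  ... | true  = cong (g x ∙_) (listSum-filterᵇ g p xs)
  ... | false = trans (listSum-filterᵇ g p xs) (≡.sym (identityˡ _))

  listSum-tabulate : ∀ {n} {B : Set} (g : B → A) (f : Fin n → B) →
                     listSum g (tabulate f) ≡ ∑[ i < n ] g (f i)
  listSum-tabulate {ℕ.zero}  g f = refl
  listSum-tabulate {ℕ.suc n} g f = cong (g (f zero) ∙_) (listSum-tabulate g (f ∘ suc))

  listSum-allFin : ∀ n {g : Fin n → A} → listSum g (allFin n) ≡ ∑[ i < n ] g i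
  listSum-allFin n {g} = listSum-tabulate g id

  ∑-split : ∀ m {n} (f : Fin (m ℕ.+ n) → A) →
            ∑[ i < m ℕ.+ n ] f i ≡ (∑[ i < m ] f (i ↑ˡ n)) ∙ (∑[ j < n ] f (m ↑ʳ j))
  ∑-split ℕ.zero    f = ≡.sym (identityˡ _)
  ∑-split (ℕ.suc m) f = trans (cong (f zero ∙_) (∑-split m (f ∘ suc))) (≡.sym (assoc _ _ _))

  ∑∑-cong : ∀ {m n} {g h : Fin m → Fin n → A} → (∀ u v → g u v ≡ h u v) →
            ∑[ u < m ] ∑[ v < n ] g u v ≡ ∑[ u < m ] ∑[ v < n ] h u v
  ∑∑-cong g≗h = sum-cong-≗ λ u → sum-cong-≗ (g≗h u)

  ∑∑-split : ∀ m n (h : Fin (m ℕ.+ n) → Fin (m ℕ.+ n) → A) →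
             ∑[ x < m ℕ.+ n ] ∑[ y < m ℕ.+ n ] h x y
             ≡ ((∑[ u < m ] ∑[ v < m ] h (u ↑ˡ n) (v ↑ˡ n))
                 ∙ (∑[ u < m ] ∑[ v < n ] h (u ↑ˡ n) (m ↑ʳ v)))
               ∙ ((∑[ u < n ] ∑[ v < m ] h (m ↑ʳ u) (v ↑ˡ n))
                 ∙ (∑[ u < n ] ∑[ v < n ] h (m ↑ʳ u) (m ↑ʳ v)))
  ∑∑-split m n h =
    trans (∑-split m (λ x → ∑[ y < m ℕ.+ n ] h x y))
    (cong₂ _∙_ (rows (_↑ˡ n)) (rows (m ↑ʳ_)))
    where
    rows : ∀ {k} (i : Fin k → Fin (m ℕ.+ n)) →
           ∑[ u < k ] ∑[ y < m ℕ.+ n ] h (i u) y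
           ≡ (∑[ u < k ] ∑[ v < m ] h (i u) (v ↑ˡ n))
             ∙ (∑[ u < k ] ∑[ v < n ] h (i u) (m ↑ʳ v))
    rows i = trans (sum-cong-≗ λ u → ∑-split m (h (i u)))
                   (∑-distrib-+ (λ u → ∑[ v < m ] h (i u) (v ↑ˡ n))
                                (λ u → ∑[ v < n ] h (i u) (m ↑ʳ v)))

  ∑-peer : ∀ {n} (g : Fin n → A) →
           ∑[ x < n ℕ.+ n ] g (peer x) ≡ (∑[ v < n ] g v) ∙ (∑[ v < n ] g v)
  ∑-peer {n} g =
    trans (∑-split n (g ∘ peer))
          (cong₂ _∙_ (sum-cong-≗ (cong g ∘ peer-↑ˡ)) (sum-cong-≗ (cong g ∘ peer-↑ʳ)))

  module _ {n : ℕ} (G : Graph n) where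

    sumOverEdges : (Fin n → Fin n → A) → A
    sumOverEdges F = listSum (λ (u , v) → F u v) (edges G)

    upperAdj : Fin n → Fin n → Bool
    upperAdj u v = ⌊ toℕ u <? toℕ v ⌋ ∧ adj G u v

    sumOverEdges-∑∑ : (F : Fin n → Fin n → A) →
                      sumOverEdges F ≡ ∑[ u < n ] ∑[ v < n ] (if upperAdj u v then F u v else ε)
    sumOverEdges-∑∑ F =
      trans (listSum-concatMap _ _ (allFin n))
      (trans (listSum-allFin n)
      (sum-cong-≗ λ u →
        trans (listSum-map _ (u ,_) (filterᵇ (upperAdj u) (allFin n)))
        (trans (listSum-filterᵇ (F u) (upperAdj u) (allFin n))
               (listSum-allFin n))))

    adj-split : (F : Fin n → Fin n → A) → (∀ u v → F u v ≡ F v u) → ∀ u v →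
                (if adj G u v then F u v else ε)
                ≡ (if upperAdj u v then F u v else ε) ∙ (if upperAdj v u then F v u else ε)
    adj-split F F-sym u v with toℕ u <? toℕ v | toℕ v <? toℕ u
    ... | yes u<v | yes v<u = contradiction v<u (<-asym u<v)
    ... | yes _   | no _    = ≡.sym (identityʳ _)
    ... | no _    | yes _   rewrite Graph.sym G u v | F-sym u v = ≡.sym (identityˡ _)
    ... | no u≮v  | no v≮u  rewrite toℕ-injective (≤-antisym (≮⇒≥ v≮u) (≮⇒≥ u≮v)) | irrefl G v =
      ≡.sym (identityˡ ε)

    ∑∑-adj≡twice : (F : Fin n → Fin n → A) → (∀ u v → F u v ≡ F v u) →
                   ∑[ u < n ] ∑[ v < n ] (if adj G u v then F u v else ε)
                   ≡ sumOverEdges F ∙ sumOverEdges F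
    ∑∑-adj≡twice F F-sym = begin
      ∑[ u < n ] ∑[ v < n ] (if adj G u v then F u v else ε)
        ≡⟨ ∑∑-cong (adj-split F F-sym) ⟩
      ∑[ u < n ] ∑[ v < n ] (upperTerm u v ∙ upperTerm v u)
        ≡⟨ sum-cong-≗ (λ u → ∑-distrib-+ (upperTerm u) (λ v → upperTerm v u)) ⟩
      ∑[ u < n ] ((∑[ v < n ] upperTerm u v) ∙ (∑[ v < n ] upperTerm v u))
        ≡⟨ ∑-distrib-+ (λ u → ∑[ v < n ] upperTerm u v) (λ u → ∑[ v < n ] upperTerm v u) ⟩
      (∑[ u < n ] ∑[ v < n ] upperTerm u v) ∙ (∑[ u < n ] ∑[ v < n ] upperTerm v u)
        ≡⟨ cong ((∑[ u < n ] ∑[ v < n ] upperTerm u v) ∙_) (∑-comm (λ u v → upperTerm v u)) ⟩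
      (∑[ u < n ] ∑[ v < n ] upperTerm u v) ∙ (∑[ v < n ] ∑[ u < n ] upperTerm v u)
        ≡⟨ cong₂ _∙_ (≡.sym (sumOverEdges-∑∑ F)) (≡.sym (sumOverEdges-∑∑ F)) ⟩
      sumOverEdges F ∙ sumOverEdges F ∎
      where
      open ≡-Reasoning
      upperTerm : Fin n → Fin n → A
      upperTerm u v = if upperAdj u v then F u v else ε

  module _ {n : ℕ} (G : Graph n) (F : Fin n → Fin n → A) where

    private
      term : Fin (n ℕ.+ n) → Fin (n ℕ.+ n) → A
      term x y = if upperAdj (shadow G) x y then F (peer x) (peer y) else ε

      term-↑ˡ-↑ˡ : ∀ u v → term (u ↑ˡ n) (v ↑ˡ n) ≡ (if upperAdj G u v then F u v else ε)
      term-↑ˡ-↑ˡ u v rewrite toℕ-↑ˡ u n | toℕ-↑ˡ v n | peer-↑ˡ u | peer-↑ˡ v = refl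

      term-↑ˡ-↑ʳ : ∀ u v → term (u ↑ˡ n) (n ↑ʳ v) ≡ (if adj G u v then F u v else ε)
      term-↑ˡ-↑ʳ u v rewrite toℕ-↑ˡ u n | toℕ-↑ʳ n v | peer-↑ˡ u | peer-↑ʳ v
        with toℕ u <? n ℕ.+ toℕ v
      ... | yes _ = refl
      ... | no u≮ = contradiction (<-≤-trans (toℕ<n u) (m≤m+n n (toℕ v))) u≮

      term-↑ʳ-↑ˡ : ∀ u v → term (n ↑ʳ u) (v ↑ˡ n) ≡ ε
      term-↑ʳ-↑ˡ u v rewrite toℕ-↑ʳ n u | toℕ-↑ˡ v n with n ℕ.+ toℕ u <? toℕ v
      ... | yes u> = contradiction u> (<-asym (<-≤-trans (toℕ<n v) (m≤m+n n (toℕ u))))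
      ... | no _  = refl

      term-↑ʳ-↑ʳ : ∀ u v → term (n ↑ʳ u) (n ↑ʳ v) ≡ (if upperAdj G u v then F u v else ε)
      term-↑ʳ-↑ʳ u v rewrite toℕ-↑ʳ n u | toℕ-↑ʳ n v | peer-↑ʳ u | peer-↑ʳ v
        with n ℕ.+ toℕ u <? n ℕ.+ toℕ v | toℕ u <? toℕ v
      ... | yes _   | yes _   = refl
      ... | no _    | no _    = refl
      ... | yes u<v | no u≮v  = contradiction (+-cancelˡ-< n _ _ u<v) u≮v
      ... | no u≮v  | yes u<v = contradiction (+-monoʳ-< n u<v) u≮v

    sumOverEdges-shadow : (∀ u v → F u v ≡ F v u) →
                          sumOverEdges (shadow G) (λ x y → F (peer x) (peer y)) ≡ 4 × sumOverEdges G F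
    sumOverEdges-shadow F-sym = begin
      sumOverEdges (shadow G) (λ x y → F (peer x) (peer y))
        ≡⟨ sumOverEdges-∑∑ (shadow G) _ ⟩
      ∑[ x < n ℕ.+ n ] ∑[ y < n ℕ.+ n ] term x y
        ≡⟨ ∑∑-split n n term ⟩
      ((∑[ u < n ] ∑[ v < n ] term (u ↑ˡ n) (v ↑ˡ n))
        ∙ (∑[ u < n ] ∑[ v < n ] term (u ↑ˡ n) (n ↑ʳ v)))
      ∙ ((∑[ u < n ] ∑[ v < n ] term (n ↑ʳ u) (v ↑ˡ n))
        ∙ (∑[ u < n ] ∑[ v < n ] term (n ↑ʳ u) (n ↑ʳ v)))
        ≡⟨ cong₂ _∙_ (cong₂ _∙_ (∑∑-cong term-↑ˡ-↑ˡ) (∑∑-cong term-↑ˡ-↑ʳ))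
                     (cong₂ _∙_ (trans (∑∑-cong term-↑ʳ-↑ˡ) ∑∑-ε) (∑∑-cong term-↑ʳ-↑ʳ)) ⟩
      ((∑[ u < n ] ∑[ v < n ] (if upperAdj G u v then F u v else ε))
        ∙ (∑[ u < n ] ∑[ v < n ] (if adj G u v then F u v else ε)))
      ∙ (ε ∙ (∑[ u < n ] ∑[ v < n ] (if upperAdj G u v then F u v else ε)))
        ≡⟨ cong₂ _∙_ (cong₂ _∙_ (≡.sym (sumOverEdges-∑∑ G F)) (∑∑-adj≡twice G F F-sym))
                     (cong (ε ∙_) (≡.sym (sumOverEdges-∑∑ G F))) ⟩
      (E ∙ (E ∙ E)) ∙ (ε ∙ E)
        ≡⟨ solve 1 (λ e → (e ⊕ (e ⊕ e)) ⊕ (∅ ⊕ e) ⊜ e ⊕ (e ⊕ (e ⊕ (e ⊕ ∅)))) refl E ⟩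
      4 × E ∎
      where
      open ≡-Reasoning
      E : A
      E = sumOverEdges G F
      ∑∑-ε : ∑[ u < n ] ∑[ v < n ] ε ≡ ε
      ∑∑-ε = trans (sum-cong-≗ {n} {y = λ _ → ε} λ _ → sum-replicate-zero n)
                   (sum-replicate-zero n)

module ℕΣ = FiniteSums ℕ.+-0-isCommutativeMonoid
module ℚΣ = FiniteSums ℚ.+-0-isCommutativeMonoid

length≡listSum : {B : Set} (xs : List B) → length xs ≡ ℕΣ.listSum (λ _ → 1) xs
length≡listSum []       = refl
length≡listSum (_ ∷ xs) = cong ℕ.suc (length≡listSum xs)

deg≡sum : ∀ {n} (G : Graph n) u → deg G u ≡ ℕΣ.sum (λ v → if adj G u v then 1 else 0)
deg≡sum {n} G u =
  trans (length≡listSum (filterᵇ (adj G u) (allFin n)))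
        (trans (ℕΣ.listSum-filterᵇ _ (adj G u) (allFin n)) (ℕΣ.listSum-allFin n))

deg-shadow : ∀ {n} (G : Graph n) x → deg (shadow G) x ≡ deg G (peer x) ℕ.+ deg G (peer x)
deg-shadow G x =
  trans (deg≡sum (shadow G) x)
        (trans (ℕΣ.∑-peer (λ v → if adj G (peer x) v then 1 else 0))
               (≡.sym (cong₂ ℕ._+_ (deg≡sum G (peer x)) (deg≡sum G (peer x)))))

numEdges-shadow : ∀ {n} (G : Graph n) → numEdges (shadow G) ≡ 4 ℕ.* numEdges G
numEdges-shadow G =
  trans (length≡listSum (edges (shadow G)))
        (trans (ℕΣ.sumOverEdges-shadow G (λ _ _ → 1) (λ _ _ → refl))
               (cong (4 ℕΣ.×_) (≡.sym (length≡listSum (edges G)))))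

+/1-homo-+ : ∀ a b → + (a ℕ.+ b) / 1 ≡ + a / 1 + + b / 1
+/1-homo-+ a b =
  trans (cong (_/ 1) (≡.sym (cong₂ ℤ._+_ (ℤ.*-identityʳ (+ a)) (ℤ.*-identityʳ (+ b)))))
        (≡.sym (cong₂ _+_ (integral a) (integral b)))
  where
  integral : ∀ c → + c / 1 ≡ mkℚ (+ c) 0 (Coprime.sym (Coprime.1-coprimeTo c))
  integral c = ℚ.↥p/↧p≡p _

1/-homo-* : ∀ j k → + 1 / (ℕ.suc j ℕ.* ℕ.suc k) ≡ (+ 1 / ℕ.suc j) * (+ 1 / ℕ.suc k)
1/-homo-* j k = ≡.sym (cong₂ _*_ (unit j) (unit k))
  where
  unit : ∀ d → + 1 / ℕ.suc d ≡ mkℚ (+ 1) d (Coprime.1-coprimeTo (ℕ.suc d))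
  unit d = ℚ.↥p/↧p≡p _

ratio? : ℚ → ℚ → Maybe ℚ
ratio? p q with q ℚ.≟ 0ℚ
... | yes _    = nothing
... | no q≢0  = just ((p ÷ q) {{≢-nonZero q≢0}})

-- The Pearson correlation of a symmetric pair (X , Y) from A = E[XY], B = E[X] = E[Y] and
-- C = E[X²] = E[Y²].
correlation : ℚ → ℚ → ℚ → Maybe ℚ
correlation A B C = ratio? (A - B * B) (C - B * B)

*-cancelˡ-≡0 : ∀ s .{{_ : NonZero s}} q → s * q ≡ 0ℚ → q ≡ 0ℚ
*-cancelˡ-≡0 s q sq≡0 = begin
  q                  ≡⟨ ≡.sym (ℚ.*-identityˡ q) ⟩
  1ℚ * q             ≡⟨ cong (_* q) (≡.sym (ℚ.*-inverseˡ s)) ⟩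
  (1/ s) * s * q     ≡⟨ ℚ.*-assoc (1/ s) s q ⟩
  (1/ s) * (s * q)   ≡⟨ cong ((1/ s) *_) sq≡0 ⟩
  (1/ s) * 0ℚ        ≡⟨ ℚ.*-zeroʳ (1/ s) ⟩
  0ℚ                 ∎
  where open ≡-Reasoning

÷-cancelˡ : ∀ s .{{_ : NonZero s}} p q .{{_ : NonZero q}} .{{_ : NonZero (s * q)}} →
            (s * p) ÷ (s * q) ≡ p ÷ q
÷-cancelˡ s p q = begin
  (s * p) * (1/ (s * q))                  ≡⟨ ≡.sym (ℚ.*-identityʳ _) ⟩
  (s * p) * (1/ (s * q)) * 1ℚ             ≡⟨ cong ((s * p) * (1/ (s * q)) *_) (≡.sym (ℚ.*-inverseˡ q)) ⟩
  (s * p) * (1/ (s * q)) * ((1/ q) * q)   ≡⟨ rearrange s p q (1/ (s * q)) (1/ q) ⟩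
  p * (1/ q) * ((1/ (s * q)) * (s * q))   ≡⟨ cong (p * (1/ q) *_) (ℚ.*-inverseˡ (s * q)) ⟩
  p * (1/ q) * 1ℚ                         ≡⟨ ℚ.*-identityʳ _ ⟩
  p * (1/ q)                              ∎
  where
  open ≡-Reasoning
  open +-*-Solver
  rearrange : ∀ s p q x y → (s * p) * x * (y * q) ≡ (p * y) * (x * (s * q))
  rearrange = solve 5 (λ s p q x y → (s :* p) :* x :* (y :* q) := (p :* y) :* (x :* (s :* q))) refl

ratio?-scale : ∀ s .{{_ : NonZero s}} p q → ratio? (s * p) (s * q) ≡ ratio? p q
ratio?-scale s p q with q ℚ.≟ 0ℚ | s * q ℚ.≟ 0ℚ
... | yes _   | yes _    = refl
... | yes q≡0 | no sq≢0  = contradiction (trans (cong (s *_) q≡0) (ℚ.*-zeroʳ s)) sq≢0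
... | no q≢0  | yes sq≡0 = contradiction (*-cancelˡ-≡0 s q sq≡0) q≢0
... | no q≢0  | no sq≢0  = cong just (÷-cancelˡ s p q {{≢-nonZero q≢0}} {{≢-nonZero sq≢0}})

correlation-scale : ∀ s .{{_ : NonZero s}} A B C →
                    correlation (s * s * A) (s * B) (s * s * C) ≡ correlation A B C
correlation-scale s A B C = begin
  ratio? (s * s * A - s * B * (s * B)) (s * s * C - s * B * (s * B))
    ≡⟨ cong₂ ratio? (factor A) (factor C) ⟩
  ratio? (s * (s * (A - B * B))) (s * (s * (C - B * B)))
    ≡⟨ ratio?-scale s _ _ ⟩
  ratio? (s * (A - B * B)) (s * (C - B * B))
    ≡⟨ ratio?-scale s _ _ ⟩
  ratio? (A - B * B) (C - B * B) ∎
  where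
  open ≡-Reasoning
  open +-*-Solver
  factor : ∀ X → s * s * X - s * B * (s * B) ≡ s * (s * (X - B * B))
  factor X = solve 3 (λ s B X → s :* s :* X :- s :* B :* (s :* B) := s :* (s :* (X :- B :* B)))
                     refl s B X

degreeℚ : ∀ {n} → Graph n → Fin n → ℚ
degreeℚ G u = + deg G u / 1

degreeℚ-shadow : ∀ {n} (G : Graph n) x →
                 degreeℚ (shadow G) x ≡ degreeℚ G (peer x) + degreeℚ G (peer x)
degreeℚ-shadow G x =
  trans (cong (λ d → + d / 1) (deg-shadow G x)) (+/1-homo-+ (deg G (peer x)) (deg G (peer x)))

listSum-*ˡ : {B : Set} (c : ℚ) (g : B → ℚ) (xs : List B) →
             ℚΣ.listSum (λ x → c * g x) xs ≡ c * ℚΣ.listSum g xs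
listSum-*ˡ c g []       = ≡.sym (ℚ.*-zeroʳ c)
listSum-*ˡ c g (x ∷ xs) =
  trans (cong (λ t → c * g x + t) (listSum-*ˡ c g xs)) (≡.sym (ℚ.*-distribˡ-+ c (g x) _))

edgeSum-shadow : ∀ {n} (G : Graph n) {f : ℚ → ℚ → ℚ} (c : ℚ) → (∀ a b → f a b ≡ f b a) →
                 (∀ a b → f (a + a) (b + b) ≡ c * f a b) →
                 edgeSum (shadow G) f ≡ 4 ℚΣ.× (c * edgeSum G f)
edgeSum-shadow G {f} c f-comm f-homogeneous = begin
  edgeSum (shadow G) f
    ≡⟨ ℚΣ.listSum-cong (λ (x , y) → cong₂ f (degreeℚ-shadow G x) (degreeℚ-shadow G y))
                       (edges (shadow G)) ⟩
  ℚΣ.sumOverEdges (shadow G) (λ x y → atDoubled (peer x) (peer y))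
    ≡⟨ ℚΣ.sumOverEdges-shadow G atDoubled (λ u v → f-comm _ _) ⟩
  4 ℚΣ.× ℚΣ.sumOverEdges G atDoubled
    ≡⟨ cong (4 ℚΣ.×_) (ℚΣ.listSum-cong (λ (u , v) → f-homogeneous (degreeℚ G u) (degreeℚ G v))
                                        (edges G)) ⟩
  4 ℚΣ.× ℚΣ.sumOverEdges G (λ u v → c * f (degreeℚ G u) (degreeℚ G v))
    ≡⟨ cong (4 ℚΣ.×_) (listSum-*ˡ c _ (edges G)) ⟩
  4 ℚΣ.× (c * edgeSum G f) ∎
  where
  open ≡-Reasoning
  atDoubled : Fin _ → Fin _ → ℚ
  atDoubled u v = f (degreeℚ G u + degreeℚ G u) (degreeℚ G v + degreeℚ G v)

edgeMean : ∀ {n} → Graph n → ℕ → (ℚ → ℚ → ℚ) → ℚ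
edgeMean G k f = + 1 / ℕ.suc k * edgeSum G f

-- suc (k + 3 (k + 1)) is 4 (k + 1) definitionally, the number of edges of G⊖.
edgeMean-shadow : ∀ {n} (G : Graph n) k {f : ℚ → ℚ → ℚ} (c : ℚ) → (∀ a b → f a b ≡ f b a) →
                  (∀ a b → f (a + a) (b + b) ≡ c * f a b) →
                  edgeMean (shadow G) (k ℕ.+ 3 ℕ.* ℕ.suc k) f ≡ c * edgeMean G k f
edgeMean-shadow G k {f} c f-comm f-homogeneous = begin
  + 1 / (4 ℕ.* ℕ.suc k) * edgeSum (shadow G) f
    ≡⟨ cong₂ _*_ (1/-homo-* 3 k) (edgeSum-shadow G c f-comm f-homogeneous) ⟩
  + 1 / 4 * X * (4 ℚΣ.× (c * edgeSum G f))
    ≡⟨ solve 3 (λ X c e → let y = c :* e in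
                 con (+ 1 / 4) :* X :* (y :+ (y :+ (y :+ (y :+ con 0ℚ)))) := c :* (X :* e))
               refl X c (edgeSum G f) ⟩
  c * (X * edgeSum G f) ∎
  where
  open ≡-Reasoning
  open +-*-Solver
  X : ℚ
  X = + 1 / ℕ.suc k

product endpointMean endpointMeanSquare : ℚ → ℚ → ℚ
product a b            = a * b
endpointMean a b       = + 1 / 2 * (a + b)
endpointMeanSquare a b = + 1 / 2 * (a * a + b * b)

assortativity≡correlation : ∀ {n} (G : Graph n) {k} → numEdges G ≡ ℕ.suc k →
  assortativity G
  ≡ correlation (edgeMean G k product) (edgeMean G k endpointMean) (edgeMean G k endpointMeanSquare)
assortativity≡correlation G {k} m≡1+k with numEdges G | m≡1+k
... | _ | refl
  with edgeMean G k endpointMeanSquare - edgeMean G k endpointMean * edgeMean G k endpointMean ℚ.≟ 0ℚ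
...   | yes _ = refl
...   | no _  = refl

assortativity-undefined : ∀ {n} (G : Graph n) → numEdges G ≡ 0 → assortativity G ≡ nothing
assortativity-undefined G m≡0 with numEdges G | m≡0
... | _ | refl = refl

two : ℚ
two = + 2 / 1

endpointMean-comm : ∀ a b → endpointMean a b ≡ endpointMean b a
endpointMean-comm a b = cong (+ 1 / 2 *_) (ℚ.+-comm a b)

endpointMeanSquare-comm : ∀ a b → endpointMeanSquare a b ≡ endpointMeanSquare b a
endpointMeanSquare-comm a b = cong (+ 1 / 2 *_) (ℚ.+-comm (a * a) (b * b))

product-homogeneous : ∀ a b → product (a + a) (b + b) ≡ two * two * product a b
product-homogeneous = solve 2 (λ a b → (a :+ a) :* (b :+ b) := con two :* con two :* (a :* b)) refl
  where open +-*-Solver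

endpointMean-homogeneous : ∀ a b → endpointMean (a + a) (b + b) ≡ two * endpointMean a b
endpointMean-homogeneous =
  solve 2 (λ a b → con (+ 1 / 2) :* ((a :+ a) :+ (b :+ b)) := con two :* (con (+ 1 / 2) :* (a :+ b)))
          refl
  where open +-*-Solver

endpointMeanSquare-homogeneous : ∀ a b →
                                 endpointMeanSquare (a + a) (b + b) ≡ two * two * endpointMeanSquare a b
endpointMeanSquare-homogeneous =
  solve 2 (λ a b → con (+ 1 / 2) :* ((a :+ a) :* (a :+ a) :+ (b :+ b) :* (b :+ b))
                   := con two :* con two :* (con (+ 1 / 2) :* (a :* a :+ b :* b)))
          refl
  where open +-*-Solver

assortativity-shadow-nonempty : ∀ {n} (G : Graph n) {k} → numEdges G ≡ ℕ.suc k →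
                                assortativity (shadow G) ≡ assortativity G
assortativity-shadow-nonempty G {k} m≡1+k = begin
  assortativity (shadow G)
    ≡⟨ assortativity≡correlation (shadow G) (trans (numEdges-shadow G) (cong (4 ℕ.*_) m≡1+k)) ⟩
  correlation (mean′ product) (mean′ endpointMean) (mean′ endpointMeanSquare)
    ≡⟨ cong₂ (λ A (B , C) → correlation A B C)
             (edgeMean-shadow G k (two * two) ℚ.*-comm product-homogeneous)
             (cong₂ _,_
               (edgeMean-shadow G k two endpointMean-comm endpointMean-homogeneous)
               (edgeMean-shadow G k (two * two) endpointMeanSquare-comm endpointMeanSquare-homogeneous)) ⟩
  correlation (two * two * mean product) (two * mean endpointMean) (two * two * mean endpointMeanSquare)
    ≡⟨ correlation-scale two (mean product) (mean endpointMean) (mean endpointMeanSquare) ⟩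
  correlation (mean product) (mean endpointMean) (mean endpointMeanSquare)
    ≡⟨ ≡.sym (assortativity≡correlation G m≡1+k) ⟩
  assortativity G ∎
  where
  open ≡-Reasoning
  mean mean′ : (ℚ → ℚ → ℚ) → ℚ
  mean  = edgeMean G k
  mean′ = edgeMean (shadow G) (k ℕ.+ 3 ℕ.* ℕ.suc k)

assortativity-shadow : ∀ {n} (G : Graph n) → assortativity (shadow G) ≡ assortativity G
assortativity-shadow G = byEdgeCount (numEdges G) refl
  where
  byEdgeCount : ∀ m → numEdges G ≡ m → assortativity (shadow G) ≡ assortativity G
  byEdgeCount ℕ.zero    m≡0   =
    trans (assortativity-undefined (shadow G) (trans (numEdges-shadow G) (cong (4 ℕ.*_) m≡0)))
          (≡.sym (assortativity-undefined G m≡0))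
  byEdgeCount (ℕ.suc k) m≡1+k = assortativity-shadow-nonempty G m≡1+k

mainTheorem11 : ∀ (n : ℕ) (G : Graph n) → Connected G → 1 ≤ numEdges G → Neutral G →
                  assortativity (shadow G) ≡ assortativity G
mainTheorem11 n G _ _ _ = assortativity-shadow G
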